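{- There is an absolute constant $c>0$ such that for every $n \geq 1$ there exist four $n$-pencils in the real projective plane whose centres are in general position (no three of the four centres are collinear) and which determine at least $c\, n^{3/2}$ $4$-rich points.
   Context: An $n$-pencil with centre $p \in P^2(\mathbb{R})$ is a set of $n$ distinct concurrent lines all passing through $p$. Given four pencils, a point is called $4$-rich if it lies on at least one line from each of the four pencils. -}

module Defs where

open import Level using (0ℓ)
open import Data.Nat using (ℕ; zero; suc)
open import Data.Fin using (Fin)
open import Data.Product using (Σ; ∃; _×_; _,_)
open import Data.Sum using (_⊎_)
open import Relation.Nullary using (¬_)
open import Relation.Binary.PropositionalEquality using (_≡_; _≢_)
open import Algebra.Structures using (IsCommutativeRing)

-- The real numbers, axiomatised as a complete ordered field (unique up to
-- isomorphism).  Equality is propositional equality.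
record RealField : Set₁ where
  infixl 6 _+_
  infixl 7 _*_
  infix 4 _<_ _≤_
  field
    Carrier : Set
    _+_ _*_ : Carrier → Carrier → Carrier
    -_      : Carrier → Carrier
    0# 1#   : Carrier
    isCommutativeRing : IsCommutativeRing _≡_ _+_ _*_ -_ 0# 1#
    0≢1     : 0# ≢ 1#
    inverse : ∀ x → x ≢ 0# → ∃ λ y → x * y ≡ 1#
    _<_     : Carrier → Carrier → Set
    <-irrefl : ∀ x → ¬ (x < x)
    <-trans  : ∀ {x y z} → x < y → y < z → x < z
    <-trichotomy : ∀ x y → x < y ⊎ x ≡ y ⊎ y < x
    +-mono-< : ∀ {x y} z → x < y → x + z < y + z
    *-pos    : ∀ {x y} → 0# < x → 0# < y → 0# < x * y

  _≤_ : Carrier → Carrier → Set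
  x ≤ y = x < y ⊎ x ≡ y

  UpperBound : (Carrier → Set) → Carrier → Set
  UpperBound P b = ∀ x → P x → x ≤ b

  field
    completeness : (P : Carrier → Set) → ∃ P → ∃ (UpperBound P) →
                   ∃ λ s → UpperBound P s × (∀ b → UpperBound P b → s ≤ b)

  fromℕ : ℕ → Carrier
  fromℕ zero    = 0#
  fromℕ (suc n) = 1# + fromℕ n

module Projective (R : RealField) where
  open RealField R

  Vec3 : Set
  Vec3 = Carrier × Carrier × Carrier

  NonZero3 : Vec3 → Set
  NonZero3 v = v ≢ (0# , 0# , 0#)

  -- v and w are proportional (cross product vanishes)
  Proportional : Vec3 → Vec3 → Set
  Proportional (a , b , c) (d , e , f) =
    (b * f ≡ c * e) × (c * d ≡ a * f) × (a * e ≡ b * d)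

  dot : Vec3 → Vec3 → Carrier
  dot (a , b , c) (d , e , f) = a * d + b * e + c * f

  -- points of P²(ℝ): nonzero triples, equal when proportional
  Point : Set
  Point = Σ Vec3 NonZero3

  -- lines of P²(ℝ): nonzero coefficient triples (ax+by+cz=0), equal when proportional
  Line : Set
  Line = Σ Vec3 NonZero3

  SamePoint : Point → Point → Set
  SamePoint (v , _) (w , _) = Proportional v w

  SameLine : Line → Line → Set
  SameLine (v , _) (w , _) = Proportional v w

  _OnLine_ : Point → Line → Set
  (v , _) OnLine (l , _) = dot l v ≡ 0#

  Collinear : Point → Point → Point → Set
  Collinear p q r = ∃ λ (l : Line) → p OnLine l × q OnLine l × r OnLine l

  record Pencil (n : ℕ) : Set where
    field
      centre   : Point
      lines    : Fin n → Line
      through  : ∀ i → centre OnLine lines i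
      distinct : ∀ i j → i ≢ j → ¬ SameLine (lines i) (lines j)

  open Pencil public

  GeneralPosition : (Fin 4 → Point) → Set
  GeneralPosition p = ∀ i j k → i ≢ j → j ≢ k → i ≢ k → ¬ Collinear (p i) (p j) (p k)

  FourRich : ∀ {n} → (Fin 4 → Pencil n) → Point → Set
  FourRich P x = ∀ k → ∃ λ i → x OnLine lines (P k) i

module Submission where

open import Defs
open import Data.Nat using (ℕ; _^_) renaming (_≤_ to _≤ℕ_)
open import Data.Fin using (Fin)
open import Data.Product using (∃; _×_; _,_; proj₁; proj₂)
open import Relation.Nullary using (¬_)
open import Relation.Binary.PropositionalEquality using (_≡_; _≢_; subst)
open import Data.Sum using (inj₁)
import Data.Nat as ℕ

-- Centres: the projective frame e₁, e₂, e₃, e₄ = (1:1:1); a line through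
-- three of them vanishes because e₁ + e₂ + e₃ = e₄.  Rich points: for
-- L = l + 1 with (2l + 1)² ≤ n < (2l + 3)², the L³ grid points
--   (N + i : 2N + 2L + j : 3N + 7L + k),   i, j, k < L,   N = K², K = 8n.
-- The line joining e₁ (resp. e₂, e₃) to a grid point only depends on
-- (j, k) (resp. (i, k), (i, j)), and the line joining e₄ only on Z − Y
-- and Y − X, i.e. on (k − j, j − i).  So each pencil needs at most n lines;
-- line number t < n is built from the digit pair (t % D, t / D).
-- Every distinctness claim (of lines and of points) reduces to one fact
-- about ℕ, ratio-injective: with offsets below K, the ratio
-- (αN + A) : (βN + B) determines (A, B).  Finally n < 9L² gives
-- n³ ≤ 729 (L³)², which is the bound with c = 1/27.

module Arithmetic where
  open import Data.Nat
  open import Data.Bool using (T)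
  open import Data.Nat.Properties
  open import Data.Nat.DivMod
  open import Data.Nat.Divisibility using (divides)
  open import Data.Product using (_×_; _,_; ∃; proj₁; proj₂)
  open import Data.Empty using (⊥-elim)
  open import Relation.Binary.PropositionalEquality
  open import Relation.Nullary using (yes; no)
  open import Relation.Binary.Definitions using (tri<; tri≈; tri>)
  open import Data.Nat.Tactic.RingSolver using (solve)
  open import Data.List using (_∷_; [])

  %-digits : ∀ D .{{_ : NonZero D}} {r} q → r < D → (r + q * D) % D ≡ r
  %-digits D {r} q r<D = trans ([m+kn]%n≡m%n r q D) (m<n⇒m%n≡m r<D)

  /-digits : ∀ D .{{_ : NonZero D}} {r} q → r < D → (r + q * D) / D ≡ q
  /-digits D {r} q r<D = begin
    (r + q * D) / D   ≡⟨ +-distrib-/-∣ʳ r (divides q refl) ⟩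
    r / D + q * D / D ≡⟨ cong₂ _+_ (m<n⇒m/n≡0 r<D) (m*n/n≡m q D) ⟩
    q                 ∎
    where open ≡-Reasoning

  divmod-injective : ∀ D .{{_ : NonZero D}} {t t'} → t % D ≡ t' % D → t / D ≡ t' / D → t ≡ t'
  divmod-injective D {t} {t'} %≡ /≡ = begin
    t                      ≡⟨ m≡m%n+[m/n]*n t D ⟩
    t % D + t / D * D      ≡⟨ cong₂ (λ r q → r + q * D) %≡ /≡ ⟩
    t' % D + t' / D * D    ≡⟨ m≡m%n+[m/n]*n t' D ⟨
    t'                     ∎
    where open ≡-Reasoning

  digits-injective : ∀ {D r r' q q'} → r < D → r' < D → r + q * D ≡ r' + q' * D → r ≡ r' × q ≡ q'
  digits-injective {D} {r} {r'} {q} {q'} r<D r'<D eq =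
    trans (sym (%-digits D q r<D)) (trans (cong (_% D) eq) (%-digits D q' r'<D)) ,
    trans (sym (/-digits D q r<D)) (trans (cong (_/ D) eq) (/-digits D q' r'<D))
    where instance _ = >-nonZero (≤-trans (s≤s z≤n) r<D)

  SameRatio : ℕ → ℕ → ℕ → ℕ → Set
  SameRatio x y x' y' = x * y' ≡ x' * y

  collinear-offset : ∀ {α β A B A' B'} → A < A' → α * B' + β * A ≡ α * B + β * A' →
                     SameRatio A B A' B' → α * B ≡ β * A
  collinear-offset {α} {β} {A} {B} {A'} {B'} A<A' tied same-ratio with m≤n⇒∃[o]m+o≡n A<A'
  ... | d , refl = *-cancelˡ-≡ (α * B) (β * A) (suc d) (+-cancelʳ-≡ (α * (A * B) + β * (A * A)) _ _ (begin
      suc d * (α * B) + (α * (A * B) + β * (A * A)) ≡⟨ solve (α ∷ β ∷ A ∷ B ∷ d ∷ []) ⟩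
      α * (suc (A + d) * B) + β * (A * A)           ≡⟨ cong (λ z → α * z + β * (A * A)) (sym same-ratio) ⟩
      α * (A * B') + β * (A * A)                    ≡⟨ solve (α ∷ β ∷ A ∷ B' ∷ []) ⟩
      A * (α * B' + β * A)                          ≡⟨ cong (A *_) tied ⟩
      A * (α * B + β * suc (A + d))                 ≡⟨ solve (α ∷ β ∷ A ∷ B ∷ d ∷ []) ⟩
      suc d * (β * A) + (α * (A * B) + β * (A * A)) ∎))
    where open ≡-Reasoning

  -- Reading (αN + A)(βN + B') in base N: when both products of offsets are
  -- below N, equal cross products force equal "carries" and equal units.
  ratio-digits : ∀ {N α β A B A' B'} → A * B' < N → A' * B < N →
                 SameRatio (α * N + A) (β * N + B) (α * N + A') (β * N + B') →
                 α * B' + β * A ≡ α * B + β * A' × A * B' ≡ A' * B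
  ratio-digits {N} {α} {β} {A} {B} {A'} {B'} AB'<N A'B<N eq =
    +-cancelˡ-≡ (α * β * N) _ _ (proj₂ split) , proj₁ split
    where
      expand : ∀ A B' → (α * N + A) * (β * N + B') ≡ A * B' + (α * β * N + (α * B' + β * A)) * N
      expand A B' = solve (N ∷ α ∷ β ∷ A ∷ B' ∷ [])
      split : A * B' ≡ A' * B × α * β * N + (α * B' + β * A) ≡ α * β * N + (α * B + β * A')
      split = digits-injective AB'<N A'B<N (trans (sym (expand A B')) (trans eq (expand A' B)))

  ratio-injective : ∀ {N K α β A B A' B'} .{{_ : NonZero α}} → K * K ≤ N →
                    A < K → B < K → A' < K → B' < K →
                    β * A < α * B → β * A' < α * B' →
                    SameRatio (α * N + A) (β * N + B) (α * N + A') (β * N + B') →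
                    A ≡ A' × B ≡ B'
  ratio-injective {N} {K} {α} {β} {A} {B} {A'} {B'} KK≤N A<K B<K A'<K B'<K off off' eq
    with ratio-digits {α = α} {β} (<-≤-trans (*-mono-< A<K B'<K) KK≤N)
                                  (<-≤-trans (*-mono-< A'<K B<K) KK≤N) eq
  ... | carries , units with <-cmp A A'
  ... | tri≈ _ refl _ = refl , *-cancelˡ-≡ B B' α (sym (+-cancelʳ-≡ (β * A) _ _ carries))
  ... | tri< A<A' _ _ = ⊥-elim (<⇒≢ off (sym (collinear-offset {α} {β} A<A' carries units)))
  ... | tri> _ _ A'<A = ⊥-elim (<⇒≢ off' (sym (collinear-offset {α} {β} A'<A (sym carries) (sym units))))

  -- The
  -- hypotheses make every offset smaller than K and keep the offset pair
  -- strictly on one side of the line αB = βA, so ratio-injective applies.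
  module OffsetRatios (N K n D α β oa ob : ℕ) .{{_ : NonZero α}} .{{_ : NonZero β}}
    (KK≤N : K * K ≤ N) (α≤β : α ≤ β) (separated : β * (oa + D) ≤ α * ob) (fits : ob + n ≤ K) where

    private
      oa+D≤ob : oa + D ≤ ob
      oa+D≤ob = *-cancelˡ-≤ β (≤-trans separated (*-monoˡ-≤ ob α≤β))

      low<K : ∀ {r} → r < D → oa + r < K
      low<K r<D = <-≤-trans (+-monoʳ-< oa r<D) (≤-trans oa+D≤ob (≤-trans (m≤m+n ob n) fits))

      high<K : ∀ {q} → q < n → ob + q < K
      high<K q<n = <-≤-trans (+-monoʳ-< ob q<n) fits

      off-diagonal : ∀ {r} q → r < D → β * (oa + r) < α * (ob + q)
      off-diagonal {r} q r<D = begin-strict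
        β * (oa + r) <⟨ *-monoʳ-< β (+-monoʳ-< oa r<D) ⟩
        β * (oa + D) ≤⟨ separated ⟩
        α * ob       ≤⟨ *-monoʳ-≤ α (m≤m+n ob q) ⟩
        α * (ob + q) ∎
        where open ≤-Reasoning

    offsets-injective : ∀ {r q r' q'} → r < D → q < n → r' < D → q' < n →
                        SameRatio (α * N + (oa + r)) (β * N + (ob + q)) (α * N + (oa + r')) (β * N + (ob + q')) →
                        r ≡ r' × q ≡ q'
    offsets-injective {r} {q} {r'} {q'} r<D q<n r'<D q'<n eq =
      +-cancelˡ-≡ oa r r' (proj₁ same) , +-cancelˡ-≡ ob q q' (proj₂ same)
      where
        same : oa + r ≡ oa + r' × ob + q ≡ ob + q'
        same = ratio-injective {N} {K} {α} {β} KK≤N (low<K r<D) (high<K q<n) (low<K r'<D) (high<K q'<n)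
                                (off-diagonal q r<D) (off-diagonal q' r'<D) eq

    index-injective : .{{_ : NonZero D}} → ∀ {t t'} → t < n → t' < n →
                      SameRatio (α * N + (oa + t % D)) (β * N + (ob + t / D))
                                (α * N + (oa + t' % D)) (β * N + (ob + t' / D)) → t ≡ t'
    index-injective {t} {t'} t<n t'<n eq = divmod-injective D (proj₁ digits≡) (proj₂ digits≡)
      where
        digits≡ : t % D ≡ t' % D × t / D ≡ t' / D
        digits≡ = offsets-injective (m%n<n t D) (≤-<-trans (m/n≤m t D) t<n)
                                    (m%n<n t' D) (≤-<-trans (m/n≤m t' D) t'<n) eq

  bracket : ∀ (f : ℕ → ℕ) → (∀ l → f l < f (suc l)) → ∀ {n} → f 0 ≤ n →
            ∃ λ l → f l ≤ n × n < f (suc l)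
  bracket f f-incr {zero} f0≤0 = 0 , f0≤0 , <-≤-trans z<s (subst (_< f 1) (n≤0⇒n≡0 f0≤0) (f-incr 0))
  bracket f f-incr {suc n} f0≤1+n with f 0 ≤? n
  ... | no f0≰n = 0 , f0≤1+n , subst (_< f 1) (≤-antisym f0≤1+n (≰⇒> f0≰n)) (f-incr 0)
  ... | yes f0≤n with bracket f f-incr f0≤n
  ...   | l , fl≤n , n<fl+1 with suc n <? f (suc l)
  ...     | yes 1+n<fl+1 = l , m≤n⇒m≤1+n fl≤n , 1+n<fl+1
  ...     | no 1+n≮fl+1 = suc l , ≮⇒≥ 1+n≮fl+1 , ≤-<-trans n<fl+1 (f-incr (suc l))

  oddSquare : ℕ → ℕ
  oddSquare l = suc (l + l) * suc (l + l)

  oddSquare-incr : ∀ l → oddSquare l < oddSquare (suc l)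
  oddSquare-incr l = *-mono-< 2l+1<2l+3 2l+1<2l+3
    where
      2l+1<2l+3 : suc (l + l) < suc (suc l + suc l)
      2l+1<2l+3 = s≤s (s≤s (+-monoʳ-≤ l (n≤1+n l)))

  cube : ℕ → ℕ
  cube L = L * (L * L)

  -- Below (2L + 1)² ≤ 9L², a cube is at most 27² (L³)².
  cube-bound : ∀ {n} l → n < oddSquare (suc l) → n ^ 3 ≤ 27 * 27 * (cube (suc l) * cube (suc l))
  cube-bound {n} l n<sq = begin
    n ^ 3                                                                     ≤⟨ ^-monoˡ-≤ 3 n≤9L² ⟩
    9 * (suc l * suc l) * (9 * (suc l * suc l) * (9 * (suc l * suc l) * 1)) ≡⟨ solve (l ∷ []) ⟩
    729 * (suc l * (suc l * suc l) * (suc l * (suc l * suc l)))             ∎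
    where
      open ≤-Reasoning
      n≤9L² : n ≤ 9 * (suc l * suc l)
      n≤9L² = begin
        n                                                                 ≤⟨ <⇒≤ n<sq ⟩
        suc (suc l + suc l) * suc (suc l + suc l)                         ≤⟨ m≤m+n _ (5 * l * l + 6 * l) ⟩
        suc (suc l + suc l) * suc (suc l + suc l) + (5 * l * l + 6 * l) ≡⟨ solve (l ∷ []) ⟩
        9 * (suc l * suc l)                                               ∎

  decode : ∀ {a} {B : Set a} D .{{_ : NonZero D}} (g : ℕ → ℕ → B) {r q} → r < D →
           g ((r + q * D) % D) ((r + q * D) / D) ≡ g r q
  decode D g {r} {q} r<D = cong₂ g (%-digits D q r<D) (/-digits D q r<D)

  index-< : ∀ {D r q} → r < D → q < D → r + q * D < D * D
  index-< {D} {r} {q} r<D q<D = <-≤-trans (+-monoˡ-< (q * D) r<D) (*-monoˡ-≤ D q<D)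

  linear-≤ : ∀ {u v} a b c d {x} → u ≡ a * x + b → v ≡ c * x + d → T (a ≤ᵇ c) → T (b ≤ᵇ d) → u ≤ v
  linear-≤ a b c d {x} u≡ v≡ a≤c b≤d =
    subst₂ _≤_ (sym u≡) (sym v≡) (+-mono-≤ (*-monoˡ-≤ x (≤ᵇ⇒≤ a c a≤c)) (≤ᵇ⇒≤ b d b≤d))

module Finite where
  open import Data.Nat using (_*_)
  open import Data.Fin using (Fin; _≟_; remQuot; combine)
  open import Data.Fin.Properties using (all?; any?; combine-remQuot)
  open import Data.Product using (∃; _,_; uncurry)
  open import Data.Sum using (_⊎_)
  open import Relation.Nullary using (¬?)
  open import Relation.Nullary.Decidable using (toWitness; _→-dec_; _⊎-dec_)
  open import Relation.Binary.PropositionalEquality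

  three-of-four : ∀ (i j k : Fin 4) → i ≢ j → j ≢ k → i ≢ k →
                  ∃ λ m → ∀ x → x ≢ m → x ≡ i ⊎ x ≡ j ⊎ x ≡ k
  three-of-four = toWitness {a? = decide} _
    where
      decide = all? λ i → all? λ j → all? λ k →
        ¬? (i ≟ j) →-dec ¬? (j ≟ k) →-dec ¬? (i ≟ k) →-dec
        any? λ m → all? λ x → ¬? (x ≟ m) →-dec (x ≟ i ⊎-dec x ≟ j ⊎-dec x ≟ k)

  remQuot-injective : ∀ {a} b {x y : Fin (a * b)} → remQuot {a} b x ≡ remQuot b y → x ≡ y
  remQuot-injective {a} b {x} {y} eq =
    trans (sym (combine-remQuot {a} b x)) (trans (cong (uncurry combine) eq) (combine-remQuot {a} b y))

module OrderedField (R : RealField) where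
  open import Data.Nat as ℕ using (ℕ; zero; suc) renaming (_≤_ to _≤ℕ_; _<_ to _<ℕ_)
  import Data.Nat.Properties as ℕ
  open import Data.Product using (_,_)
  open import Data.Sum using (inj₁; inj₂)
  open import Data.Empty using (⊥-elim)
  open import Relation.Binary.PropositionalEquality
  open import Relation.Binary.Definitions using (tri<; tri≈; tri>)
  open import Algebra.Bundles using (CommutativeRing)

  open RealField R public

  commutativeRing : CommutativeRing _ _
  commutativeRing = record { isCommutativeRing = isCommutativeRing }

  open CommutativeRing commutativeRing public
    using (+-comm; +-identityˡ; +-identityʳ; -‿inverseˡ; -‿inverseʳ; *-assoc; *-comm; *-identityˡ; *-identityʳ;
           zeroˡ; zeroʳ; distribˡ; +-commutativeSemigroup; *-commutativeSemigroup; ring; semiring)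
  open import Algebra.Properties.Ring ring public
    using (-‿distribˡ-*; -‿distribʳ-*; -1*x≈-x; -‿involutive; -‿injective)
  open import Algebra.Properties.CommutativeSemigroup *-commutativeSemigroup as *-CS using ()
  open import Algebra.Properties.Semiring.Mult semiring using (×-homo-+; ×1-homo-*) renaming (_×_ to _·_)

  -- fromℕ n is the scalar multiple n · 1#, so fromℕ is a semiring homomorphism.
  fromℕ≡·1# : ∀ n → fromℕ n ≡ n · 1#
  fromℕ≡·1# zero    = refl
  fromℕ≡·1# (suc n) = cong (1# +_) (fromℕ≡·1# n)

  fromℕ-+ : ∀ m n → fromℕ (m ℕ.+ n) ≡ fromℕ m + fromℕ n
  fromℕ-+ m n = begin
    fromℕ (m ℕ.+ n)         ≡⟨ fromℕ≡·1# (m ℕ.+ n) ⟩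
    (m ℕ.+ n) · 1#          ≡⟨ ×-homo-+ 1# m n ⟩
    m · 1# + n · 1#         ≡⟨ sym (cong₂ _+_ (fromℕ≡·1# m) (fromℕ≡·1# n)) ⟩
    fromℕ m + fromℕ n       ∎
    where open ≡-Reasoning

  fromℕ-* : ∀ m n → fromℕ (m ℕ.* n) ≡ fromℕ m * fromℕ n
  fromℕ-* m n = begin
    fromℕ (m ℕ.* n)         ≡⟨ fromℕ≡·1# (m ℕ.* n) ⟩
    (m ℕ.* n) · 1#          ≡⟨ ×1-homo-* m n ⟩
    (m · 1#) * (n · 1#)     ≡⟨ sym (cong₂ _*_ (fromℕ≡·1# m) (fromℕ≡·1# n)) ⟩
    fromℕ m * fromℕ n       ∎
    where open ≡-Reasoning

  -- Positivity of 1# is forced by the order axioms: if 1# < 0# then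
  -- 0# < -1#, and then 0# < (-1#)(-1#) = 1#.
  0<1 : 0# < 1#
  0<1 with <-trichotomy 0# 1#
  ... | inj₁ 0<1          = 0<1
  ... | inj₂ (inj₁ 0≡1)   = ⊥-elim (0≢1 0≡1)
  ... | inj₂ (inj₂ 1<0)   = ⊥-elim (<-irrefl 1# (<-trans 1<0 0<1'))
    where
      0<-1 : 0# < - 1#
      0<-1 = subst₂ _<_ (-‿inverseʳ 1#) (+-identityˡ (- 1#)) (+-mono-< (- 1#) 1<0)
      0<1' : 0# < 1#
      0<1' = subst (0# <_) (trans (-1*x≈-x (- 1#)) (-‿involutive 1#)) (*-pos 0<-1 0<-1)

  x<x+y : ∀ {x y} → 0# < y → x < x + y
  x<x+y {x} {y} 0<y = subst₂ _<_ (+-identityˡ x) (+-comm y x) (+-mono-< x 0<y)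

  fromℕ-pos : ∀ n → 0# < fromℕ (suc n)
  fromℕ-pos zero    = subst (0# <_) (sym (+-identityʳ 1#)) 0<1
  fromℕ-pos (suc n) = <-trans (fromℕ-pos n) (subst (fromℕ (suc n) <_) (+-comm _ 1#) (x<x+y 0<1))

  fromℕ-mono-< : ∀ {m n} → m <ℕ n → fromℕ m < fromℕ n
  fromℕ-mono-< {m} m<n with ℕ.m≤n⇒∃[o]m+o≡n m<n
  ... | o , refl = subst (fromℕ m <_) (sym (trans (cong fromℕ (sym (ℕ.+-suc m o))) (fromℕ-+ m (suc o))))
                         (x<x+y (fromℕ-pos o))

  fromℕ-injective : ∀ {m n} → fromℕ m ≡ fromℕ n → m ≡ n
  fromℕ-injective {m} {n} eq with ℕ.<-cmp m n
  ... | tri< m<n _ _ = ⊥-elim (<-irrefl _ (subst (_< fromℕ n) eq (fromℕ-mono-< m<n)))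
  ... | tri≈ _ m≡n _ = m≡n
  ... | tri> _ _ n<m = ⊥-elim (<-irrefl _ (subst (_< fromℕ m) (sym eq) (fromℕ-mono-< n<m)))

  fromℕ-nonzero : ∀ {n} → n ≢ 0 → fromℕ n ≢ 0#
  fromℕ-nonzero n≢0 eq = n≢0 (fromℕ-injective eq)

  inverse-pos : ∀ {x y} → 0# < x → x * y ≡ 1# → 0# < y
  inverse-pos {x} {y} 0<x xy≡1 with <-trichotomy 0# y
  ... | inj₁ 0<y        = 0<y
  ... | inj₂ (inj₁ 0≡y) = ⊥-elim (0≢1 (trans (sym (zeroʳ x)) (trans (cong (x *_) 0≡y) xy≡1)))
  ... | inj₂ (inj₂ y<0) = ⊥-elim (<-irrefl 0# (<-trans 0<1 1<0))
    where
      0<-y : 0# < - y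
      0<-y = subst₂ _<_ (-‿inverseʳ y) (+-identityˡ (- y)) (+-mono-< (- y) y<0)
      0<-1 : 0# < - 1#
      0<-1 = subst (0# <_) (trans (sym (-‿distribʳ-* x y)) (cong -_ xy≡1)) (*-pos 0<x 0<-y)
      1<0 : 1# < 0#
      1<0 = subst₂ _<_ (+-identityˡ 1#) (-‿inverseˡ 1#) (+-mono-< 1# 0<-1)

  x≤x+y : ∀ {x y} → 0# ≤ y → x ≤ x + y
  x≤x+y (inj₁ 0<y)         = inj₁ (x<x+y 0<y)
  x≤x+y {x} (inj₂ refl)    = inj₂ (sym (+-identityʳ x))

  nonneg-* : ∀ {x y} → 0# ≤ x → 0# ≤ y → 0# ≤ x * y
  nonneg-* (inj₁ 0<x) (inj₁ 0<y) = inj₁ (*-pos 0<x 0<y)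
  nonneg-* {x} _ (inj₂ refl)     = inj₂ (sym (zeroʳ x))
  nonneg-* {y = y} (inj₂ refl) _ = inj₂ (sym (zeroˡ y))

  fromℕ-nonneg : ∀ n → 0# ≤ fromℕ n
  fromℕ-nonneg zero    = inj₂ refl
  fromℕ-nonneg (suc n) = inj₁ (fromℕ-pos n)

  scaled-fromℕ-mono : ∀ {z a b} → 0# ≤ z → a ≤ℕ b → z * fromℕ a ≤ z * fromℕ b
  scaled-fromℕ-mono {z} {a} 0≤z a≤b with ℕ.m≤n⇒∃[o]m+o≡n a≤b
  ... | o , refl = subst (z * fromℕ a ≤_) (sym (trans (cong (z *_) (fromℕ-+ a o)) (distribˡ z (fromℕ a) (fromℕ o))))
                         (x≤x+y (nonneg-* 0≤z (fromℕ-nonneg o)))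

  reciprocal-bound : ∀ d b {c a} → fromℕ d * c ≡ 1# → 0# ≤ c → a ≤ℕ d ℕ.* d ℕ.* b →
                     c * c * fromℕ a ≤ fromℕ b
  reciprocal-bound d b {c} {a} dc≡1 0≤c a≤d²b =
    subst (c * c * fromℕ a ≤_) c²d²b≡b (scaled-fromℕ-mono (nonneg-* 0≤c 0≤c) a≤d²b)
    where
      open ≡-Reasoning
      c²d²b≡b : c * c * fromℕ (d ℕ.* d ℕ.* b) ≡ fromℕ b
      c²d²b≡b = begin
        c * c * fromℕ (d ℕ.* d ℕ.* b)                 ≡⟨ cong (c * c *_) (trans (fromℕ-* (d ℕ.* d) b) (cong (_* fromℕ b) (fromℕ-* d d))) ⟩
        c * c * (fromℕ d * fromℕ d * fromℕ b)         ≡⟨ sym (*-assoc _ _ _) ⟩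
        c * c * (fromℕ d * fromℕ d) * fromℕ b         ≡⟨ cong (_* fromℕ b) (*-CS.interchange c c (fromℕ d) (fromℕ d)) ⟩
        c * fromℕ d * (c * fromℕ d) * fromℕ b         ≡⟨ cong (λ u → u * u * fromℕ b) (trans (*-comm c (fromℕ d)) dc≡1) ⟩
        1# * 1# * fromℕ b                             ≡⟨ trans (cong (_* fromℕ b) (*-identityʳ 1#)) (*-identityˡ _) ⟩
        fromℕ b                                       ∎

module Plane (R : RealField) where
  open import Data.Nat as ℕ using (ℕ)
  import Data.Nat.Properties as ℕ
  open import Data.Fin as Fin using (Fin)
  open import Data.Fin.Properties using (toℕ-injective; toℕ<n; toℕ-fromℕ<)
  open import Data.Product using (∃; _×_; _,_; proj₁; proj₂)
  open import Data.Sum using (inj₁; inj₂)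
  open import Relation.Binary.PropositionalEquality
  open import Data.Fin.Patterns using (0F; 1F; 2F; 3F)
  open import Function using (_∘_)
  open import Data.List using (_∷_; [])
  import Data.Nat.Tactic.RingSolver as NatSolver

  open Arithmetic using (SameRatio)
  open Finite using (three-of-four)
  open OrderedField R
  open import Algebra.Properties.CommutativeSemigroup +-commutativeSemigroup as +-CS using ()
  open ≡-Reasoning
  open Projective R

  e₁ e₂ e₃ e₄ : Vec3
  e₁ = 1# , 0# , 0#
  e₂ = 0# , 1# , 0#
  e₃ = 0# , 0# , 1#
  e₄ = 1# , 1# , 1#

  frame : Fin 4 → Vec3
  frame 0F = e₁
  frame 1F = e₂
  frame 2F = e₃
  frame 3F = e₄

  frame-nonzero : ∀ k → NonZero3 (frame k)
  frame-nonzero 0F eq = 0≢1 (sym (cong proj₁ eq))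
  frame-nonzero 1F eq = 0≢1 (sym (cong (proj₁ ∘ proj₂) eq))
  frame-nonzero 2F eq = 0≢1 (sym (cong (proj₂ ∘ proj₂) eq))
  frame-nonzero 3F eq = 0≢1 (sym (cong proj₁ eq))

  dot-e₁ : ∀ a b c → dot (a , b , c) e₁ ≡ a
  dot-e₁ a b c = trans (cong₂ _+_ (cong₂ _+_ (*-identityʳ a) (zeroʳ b)) (zeroʳ c))
                       (trans (+-identityʳ _) (+-identityʳ a))

  dot-e₂ : ∀ a b c → dot (a , b , c) e₂ ≡ b
  dot-e₂ a b c = trans (cong₂ _+_ (cong₂ _+_ (zeroʳ a) (*-identityʳ b)) (zeroʳ c))
                       (trans (+-identityʳ _) (+-identityˡ b))

  dot-e₃ : ∀ a b c → dot (a , b , c) e₃ ≡ c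
  dot-e₃ a b c = trans (cong₂ _+_ (cong₂ _+_ (zeroʳ a) (zeroʳ b)) (*-identityʳ c))
                       (trans (cong (_+ c) (+-identityʳ 0#)) (+-identityˡ c))

  dot-e₄ : ∀ a b c → dot (a , b , c) e₄ ≡ a + b + c
  dot-e₄ a b c = cong₂ _+_ (cong₂ _+_ (*-identityʳ a) (*-identityʳ b)) (*-identityʳ c)

  -- A line through all frame points but (at most) one is the zero vector:
  -- the frame points satisfy the single relation e₁ + e₂ + e₃ = e₄.
  vanishes-off : ∀ a b c m → (∀ x → x ≢ m → dot (a , b , c) (frame x) ≡ 0#) →
                 (a , b , c) ≡ (0# , 0# , 0#)
  vanishes-off a b c 0F on
    with trans (sym (dot-e₂ a b c)) (on 1F λ ()) | trans (sym (dot-e₃ a b c)) (on 2F λ ())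
  ... | refl | refl = cong (_, 0# , 0#) (begin
    a              ≡⟨ sym (trans (+-identityʳ _) (+-identityʳ a)) ⟩
    a + 0# + 0#    ≡⟨ sym (dot-e₄ a 0# 0#) ⟩
    dot (a , 0# , 0#) e₄ ≡⟨ on 3F (λ ()) ⟩
    0#             ∎)
  vanishes-off a b c 1F on
    with trans (sym (dot-e₁ a b c)) (on 0F λ ()) | trans (sym (dot-e₃ a b c)) (on 2F λ ())
  ... | refl | refl = cong (λ b → 0# , b , 0#) (begin
    b              ≡⟨ sym (trans (+-identityʳ _) (+-identityˡ b)) ⟩
    0# + b + 0#    ≡⟨ sym (dot-e₄ 0# b 0#) ⟩
    dot (0# , b , 0#) e₄ ≡⟨ on 3F (λ ()) ⟩
    0#             ∎)
  vanishes-off a b c 2F on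
    with trans (sym (dot-e₁ a b c)) (on 0F λ ()) | trans (sym (dot-e₂ a b c)) (on 1F λ ())
  ... | refl | refl = cong (λ c → 0# , 0# , c) (begin
    c              ≡⟨ sym (trans (cong (_+ c) (+-identityʳ 0#)) (+-identityˡ c)) ⟩
    0# + 0# + c    ≡⟨ sym (dot-e₄ 0# 0# c) ⟩
    dot (0# , 0# , c) e₄ ≡⟨ on 3F (λ ()) ⟩
    0#             ∎)
  vanishes-off a b c 3F on
    with trans (sym (dot-e₁ a b c)) (on 0F λ ()) | trans (sym (dot-e₂ a b c)) (on 1F λ ())
       | trans (sym (dot-e₃ a b c)) (on 2F λ ())
  ... | refl | refl | refl = refl

  frame-general-position : (p : Fin 4 → Point) → (∀ k → proj₁ (p k) ≡ frame k) → GeneralPosition p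
  frame-general-position p p≡frame i j k i≢j j≢k i≢k (((a , b , c) , l≢0) , on-i , on-j , on-k)
    with three-of-four i j k i≢j j≢k i≢k
  ... | m , covered = l≢0 (vanishes-off a b c m on-frame)
    where
      on-frame : ∀ x → x ≢ m → dot (a , b , c) (frame x) ≡ 0#
      on-frame x x≢m with covered x x≢m
      ... | inj₁ refl        = subst (λ v → dot (a , b , c) v ≡ 0#) (p≡frame x) on-i
      ... | inj₂ (inj₁ refl) = subst (λ v → dot (a , b , c) v ≡ 0#) (p≡frame x) on-j
      ... | inj₂ (inj₂ refl) = subst (λ v → dot (a , b , c) v ≡ 0#) (p≡frame x) on-k

  dot-neg₂ : ∀ {a b c x y z} → a * x + c * z ≡ b * y → dot (a , - b , c) (x , y , z) ≡ 0#
  dot-neg₂ {a} {b} {c} {x} {y} {z} balance = begin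
    a * x + - b * y + c * z     ≡⟨ cong (λ w → a * x + w + c * z) (sym (-‿distribˡ-* b y)) ⟩
    a * x + - (b * y) + c * z   ≡⟨ +-CS.xy∙z≈xz∙y _ _ _ ⟩
    a * x + c * z + - (b * y)   ≡⟨ cong (λ w → w + - (b * y)) balance ⟩
    b * y + - (b * y)           ≡⟨ -‿inverseʳ _ ⟩
    0#                          ∎

  dot-neg₃ : ∀ {a b c x y z} → a * x + b * y ≡ c * z → dot (a , b , - c) (x , y , z) ≡ 0#
  dot-neg₃ {a} {b} {c} {x} {y} {z} balance = begin
    a * x + b * y + - c * z     ≡⟨ cong₂ _+_ balance (sym (-‿distribˡ-* c z)) ⟩
    c * z + - (c * z)           ≡⟨ -‿inverseʳ _ ⟩
    0#                          ∎

  drop-zeroʳ : ∀ u v w → u * v + 0# * w ≡ v * u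
  drop-zeroʳ u v w = trans (cong (u * v +_) (zeroˡ w)) (trans (+-identityʳ _) (*-comm u v))

  point : ℕ → ℕ → ℕ → Vec3
  point X Y Z = fromℕ X , fromℕ Y , fromℕ Z

  -- The lines joining e₁, e₂, e₃ to (X : Y : Z) depend on two coordinates only;
  -- line₄ a c joins e₄ to (X : Y : Z) whenever a + Y = Z and c + X = Y.
  line₁ line₂ line₃ line₄ : ℕ → ℕ → Vec3
  line₁ Y Z = 0# , - fromℕ Z , fromℕ Y
  line₂ X Z = fromℕ Z , 0# , - fromℕ X
  line₃ X Y = fromℕ Y , - fromℕ X , 0#
  line₄ a c = fromℕ a , - fromℕ (a ℕ.+ c) , fromℕ c

  through₁ : ∀ Y Z → dot (line₁ Y Z) e₁ ≡ 0#
  through₁ Y Z = dot-e₁ _ _ _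

  through₂ : ∀ X Z → dot (line₂ X Z) e₂ ≡ 0#
  through₂ X Z = dot-e₂ _ _ _

  through₃ : ∀ X Y → dot (line₃ X Y) e₃ ≡ 0#
  through₃ X Y = dot-e₃ _ _ _

  through₄ : ∀ a c → dot (line₄ a c) e₄ ≡ 0#
  through₄ a c = dot-neg₂ (begin
    fromℕ a * 1# + fromℕ c * 1#  ≡⟨ cong₂ _+_ (*-identityʳ _) (*-identityʳ _) ⟩
    fromℕ a + fromℕ c            ≡⟨ sym (fromℕ-+ a c) ⟩
    fromℕ (a ℕ.+ c)              ≡⟨ sym (*-identityʳ _) ⟩
    fromℕ (a ℕ.+ c) * 1#         ∎)

  incident₁ : ∀ X Y Z → dot (line₁ Y Z) (point X Y Z) ≡ 0#
  incident₁ X Y Z = dot-neg₂ (trans (+-comm _ _) (drop-zeroʳ (fromℕ Y) (fromℕ Z) (fromℕ X)))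

  incident₂ : ∀ X Y Z → dot (line₂ X Z) (point X Y Z) ≡ 0#
  incident₂ X Y Z = dot-neg₃ (drop-zeroʳ (fromℕ Z) (fromℕ X) (fromℕ Y))

  incident₃ : ∀ X Y Z → dot (line₃ X Y) (point X Y Z) ≡ 0#
  incident₃ X Y Z = dot-neg₂ (drop-zeroʳ (fromℕ Y) (fromℕ X) (fromℕ Z))

  incident₄ : ∀ a c X Y Z → a ℕ.+ Y ≡ Z → c ℕ.+ X ≡ Y → dot (line₄ a c) (point X Y Z) ≡ 0#
  incident₄ a c X Y Z a+Y≡Z c+X≡Y = dot-neg₂ (begin
    fromℕ a * fromℕ X + fromℕ c * fromℕ Z     ≡⟨ sym (cong₂ _+_ (fromℕ-* a X) (fromℕ-* c Z)) ⟩
    fromℕ (a ℕ.* X) + fromℕ (c ℕ.* Z)         ≡⟨ sym (fromℕ-+ (a ℕ.* X) (c ℕ.* Z)) ⟩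
    fromℕ (a ℕ.* X ℕ.+ c ℕ.* Z)               ≡⟨ cong fromℕ (balance a+Y≡Z c+X≡Y) ⟩
    fromℕ ((a ℕ.+ c) ℕ.* Y)                   ≡⟨ fromℕ-* (a ℕ.+ c) Y ⟩
    fromℕ (a ℕ.+ c) * fromℕ Y                 ∎)
    where
      balance : ∀ {a c X Y Z} → a ℕ.+ Y ≡ Z → c ℕ.+ X ≡ Y → a ℕ.* X ℕ.+ c ℕ.* Z ≡ (a ℕ.+ c) ℕ.* Y
      balance {a} {c} {X} refl refl = NatSolver.solve (a ∷ c ∷ X ∷ [])

  fromℕ-cross : ∀ x y z w → fromℕ x * fromℕ y ≡ fromℕ z * fromℕ w → x ℕ.* y ≡ z ℕ.* w
  fromℕ-cross x y z w eq = fromℕ-injective (trans (fromℕ-* x y) (trans eq (sym (fromℕ-* z w))))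

  neg-cross : ∀ {u v w t} → - u * v ≡ w * - t → u * v ≡ w * t
  neg-cross {u} {v} {w} {t} eq = -‿injective (trans (-‿distribˡ-* u v) (trans eq (sym (-‿distribʳ-* w t))))

  ratio₁ : ∀ Y Z Y' Z' → Proportional (line₁ Y Z) (line₁ Y' Z') → SameRatio Y Z Y' Z'
  ratio₁ Y Z Y' Z' (eq , _ , _) = trans (sym (fromℕ-cross Z Y' Y Z' (neg-cross eq))) (ℕ.*-comm Z Y')

  ratio₂ : ∀ X Z X' Z' → Proportional (line₂ X Z) (line₂ X' Z') → SameRatio X Z X' Z'
  ratio₂ X Z X' Z' (_ , eq , _) = trans (fromℕ-cross X Z' Z X' (neg-cross eq)) (ℕ.*-comm Z X')

  ratio₃ : ∀ X Y X' Y' → Proportional (line₃ X Y) (line₃ X' Y') → SameRatio X Y X' Y'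
  ratio₃ X Y X' Y' (_ , _ , eq) = trans (fromℕ-cross X Y' Y X' (neg-cross (sym eq))) (ℕ.*-comm Y X')

  ratio₄ : ∀ a c a' c' → Proportional (line₄ a c) (line₄ a' c') → SameRatio c a c' a'
  ratio₄ a c a' c' (_ , eq , _) = trans (fromℕ-cross c a' a c' eq) (ℕ.*-comm a c')

  ratio-points : ∀ X Y Z X' Y' Z' → Proportional (point X Y Z) (point X' Y' Z') →
                 SameRatio X Y X' Y' × SameRatio X Z X' Z'
  ratio-points X Y Z X' Y' Z' (_ , eq₂ , eq₃) =
    trans (fromℕ-cross X Y' Y X' eq₃) (ℕ.*-comm Y X') ,
    trans (sym (fromℕ-cross Z X' X Z' eq₂)) (ℕ.*-comm Z X')

  point-nonzero : ∀ X Y Z → X ≢ 0 → NonZero3 (point X Y Z)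
  point-nonzero X Y Z X≢0 eq = fromℕ-nonzero X≢0 (cong proj₁ eq)

  line₁-nonzero : ∀ Y Z → Y ≢ 0 → NonZero3 (line₁ Y Z)
  line₁-nonzero Y Z Y≢0 eq = fromℕ-nonzero Y≢0 (cong (proj₂ ∘ proj₂) eq)

  line₂-nonzero : ∀ X Z → Z ≢ 0 → NonZero3 (line₂ X Z)
  line₂-nonzero X Z Z≢0 eq = fromℕ-nonzero Z≢0 (cong proj₁ eq)

  line₃-nonzero : ∀ X Y → Y ≢ 0 → NonZero3 (line₃ X Y)
  line₃-nonzero X Y Y≢0 eq = fromℕ-nonzero Y≢0 (cong proj₁ eq)

  line₄-nonzero : ∀ a c → a ≢ 0 → NonZero3 (line₄ a c)
  line₄-nonzero a c a≢0 eq = fromℕ-nonzero a≢0 (cong proj₁ eq)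

  module PencilOf (n : ℕ) (c : Point) (ℓ : ℕ → Line) (through : ∀ t → c OnLine ℓ t)
    (injective : ∀ t t' → t ℕ.< n → t' ℕ.< n → SameLine (ℓ t) (ℓ t') → t ≡ t') where

    pencil : Pencil n
    pencil = record
      { centre   = c
      ; lines    = λ s → ℓ (Fin.toℕ s)
      ; through  = λ s → through (Fin.toℕ s)
      ; distinct = λ s s' s≢s' same →
          s≢s' (toℕ-injective (injective _ _ (toℕ<n s) (toℕ<n s') same))
      }

    on-pencil : ∀ {t} x → t ℕ.< n → x OnLine ℓ t → ∃ λ s → x OnLine lines pencil s
    on-pencil {t} x t<n on = Fin.fromℕ< t<n , subst (λ u → x OnLine ℓ u) (sym (toℕ-fromℕ< t<n)) on

module Construction (R : RealField) (n l : ℕ) (W²≤n : Arithmetic.oddSquare l ≤ℕ n) where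
  open import Data.Nat
  open import Data.Nat.Properties
  open import Data.Nat.DivMod using (_%_; _/_)
  open import Data.Fin using (Fin; toℕ; remQuot)
  open import Data.Fin.Patterns using (0F; 1F; 2F; 3F)
  open import Data.Fin.Properties using (toℕ<n; toℕ-injective)
  open import Data.Product using (_×_; _,_; proj₁; proj₂)
  open import Data.List using (_∷_; [])
  open import Relation.Nullary using (¬_)
  open import Relation.Binary.PropositionalEquality
  open import Data.Nat.Tactic.RingSolver using (solve; solve-∀)

  open Arithmetic
  open Finite using (remQuot-injective)
  open RealField R using (0#)
  open Projective R
  open Plane R

  -- Grid side L, difference range W = 2L − 1, offsets below K, base N = K².
  L W K N : ℕ
  L = suc l
  W = suc (l + l)
  K = 8 * n
  N = K * K

  L≤W : L ≤ W
  L≤W = s≤s (m≤m+n l l)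

  W≤n : W ≤ n
  W≤n = ≤-trans (m≤m*n W W) W²≤n

  L≤n : L ≤ n
  L≤n = ≤-trans L≤W W≤n

  L²≤n : L * L ≤ n
  L²≤n = ≤-trans (*-mono-≤ L≤W L≤W) W²≤n

  scaled-nonzero : ∀ α x .{{_ : NonZero α}} → α * N + x ≢ 0
  scaled-nonzero α x eq = <⇒≢ (<-≤-trans N-pos (≤-trans (m≤n*m N α) (m≤m+n (α * N) x))) (sym eq)
    where
      K-pos : 0 < K
      K-pos = *-monoʳ-< 8 (≤-trans (s≤s z≤n) L≤n)
      N-pos : 0 < N
      N-pos = *-mono-< K-pos K-pos

  X Y Z : ℕ → ℕ
  X i = 1 * N + i
  Y j = 2 * N + (2 * L + j)
  Z k = 3 * N + (7 * L + k)

  fits : ∀ {ob} → ob ≤ 7 * L → ob + n ≤ K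
  fits {ob} ob≤7L = begin
    ob + n      ≤⟨ +-monoˡ-≤ n (≤-trans ob≤7L (*-monoʳ-≤ 7 L≤n)) ⟩
    7 * n + n   ≡⟨ solve (n ∷ []) ⟩
    8 * n       ∎
    where open ≤-Reasoning

  -- Linear comparisons needed by the ratio families, with L = suc l and
  -- W = suc (l + l) written out so that they can be normalised.
  sep₁ : 3 * (2 * suc l + suc l) ≤ 2 * (7 * suc l)
  sep₁ = linear-≤ 9 9 14 14 {l} (solve (l ∷ [])) (solve (l ∷ [])) _ _
  sep₂ : 3 * (0 + suc l) ≤ 1 * (7 * suc l)
  sep₂ = linear-≤ 3 3 7 7 {l} (solve (l ∷ [])) (solve (l ∷ [])) _ _
  sep₃ : 2 * (0 + suc l) ≤ 1 * (2 * suc l)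
  sep₃ = linear-≤ 2 2 2 2 {l} (solve (l ∷ [])) (solve (l ∷ [])) _ _
  sep₄ : 1 * (suc l + 1 + suc (l + l)) ≤ 1 * (4 * suc l + 1)
  sep₄ = linear-≤ 3 3 4 5 {l} (solve (l ∷ [])) (solve (l ∷ [])) _ _
  2L≤7L : 2 * suc l ≤ 7 * suc l
  2L≤7L = linear-≤ 2 2 7 7 {l} (solve (l ∷ [])) (solve (l ∷ [])) _ _
  4L+1≤7L : 4 * suc l + 1 ≤ 7 * suc l
  4L+1≤7L = linear-≤ 4 5 7 7 {l} (solve (l ∷ [])) (solve (l ∷ [])) _ _

  module R₁ = OffsetRatios N K n L 2 3 (2 * L) (7 * L) ≤-refl (≤ᵇ⇒≤ 2 3 _) sep₁ (fits ≤-refl)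
  module R₂ = OffsetRatios N K n L 1 3 0 (7 * L) ≤-refl (≤ᵇ⇒≤ 1 3 _) sep₂ (fits ≤-refl)
  module R₃ = OffsetRatios N K n L 1 2 0 (2 * L) ≤-refl (≤ᵇ⇒≤ 1 2 _) sep₃ (fits 2L≤7L)
  module R₄ = OffsetRatios N K n W 1 1 (L + 1) (4 * L + 1) ≤-refl ≤-refl sep₄ (fits 4L+1≤7L)

  -- Line number t of each pencil: its index t is read as a digit pair.
  -- The line through e₄ is determined by a = Z − Y and c = Y − X.
  a₄ c₄ : ℕ → ℕ
  a₄ t = 1 * N + (4 * L + 1 + t / W)
  c₄ t = 1 * N + (L + 1 + t % W)

  ℓ₁ ℓ₂ ℓ₃ ℓ₄ : ℕ → Line
  ℓ₁ t = line₁ (Y (t % L)) (Z (t / L)) , line₁-nonzero (Y (t % L)) (Z (t / L)) (scaled-nonzero 2 _)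
  ℓ₂ t = line₂ (X (t % L)) (Z (t / L)) , line₂-nonzero (X (t % L)) (Z (t / L)) (scaled-nonzero 3 _)
  ℓ₃ t = line₃ (X (t % L)) (Y (t / L)) , line₃-nonzero (X (t % L)) (Y (t / L)) (scaled-nonzero 2 _)
  ℓ₄ t = line₄ (a₄ t) (c₄ t) , line₄-nonzero (a₄ t) (c₄ t) (scaled-nonzero 1 _)

  ℓ₁-injective : ∀ t t' → t < n → t' < n → SameLine (ℓ₁ t) (ℓ₁ t') → t ≡ t'
  ℓ₁-injective t t' t<n t'<n same =
    R₁.index-injective t<n t'<n (ratio₁ (Y (t % L)) (Z (t / L)) (Y (t' % L)) (Z (t' / L)) same)

  ℓ₂-injective : ∀ t t' → t < n → t' < n → SameLine (ℓ₂ t) (ℓ₂ t') → t ≡ t'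
  ℓ₂-injective t t' t<n t'<n same =
    R₂.index-injective t<n t'<n (ratio₂ (X (t % L)) (Z (t / L)) (X (t' % L)) (Z (t' / L)) same)

  ℓ₃-injective : ∀ t t' → t < n → t' < n → SameLine (ℓ₃ t) (ℓ₃ t') → t ≡ t'
  ℓ₃-injective t t' t<n t'<n same =
    R₃.index-injective t<n t'<n (ratio₃ (X (t % L)) (Y (t / L)) (X (t' % L)) (Y (t' / L)) same)

  ℓ₄-injective : ∀ t t' → t < n → t' < n → SameLine (ℓ₄ t) (ℓ₄ t') → t ≡ t'
  ℓ₄-injective t t' t<n t'<n same =
    R₄.index-injective t<n t'<n (ratio₄ (a₄ t) (c₄ t) (a₄ t') (c₄ t') same)

  centre₀ : Fin 4 → Point
  centre₀ k = frame k , frame-nonzero k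

  module P₁ = PencilOf n (centre₀ 0F) ℓ₁ (λ t → through₁ (Y (t % L)) (Z (t / L))) ℓ₁-injective
  module P₂ = PencilOf n (centre₀ 1F) ℓ₂ (λ t → through₂ (X (t % L)) (Z (t / L))) ℓ₂-injective
  module P₃ = PencilOf n (centre₀ 2F) ℓ₃ (λ t → through₃ (X (t % L)) (Y (t / L))) ℓ₃-injective
  module P₄ = PencilOf n (centre₀ 3F) ℓ₄ (λ t → through₄ (a₄ t) (c₄ t)) ℓ₄-injective

  P : Fin 4 → Pencil n
  P 0F = P₁.pencil
  P 1F = P₂.pencil
  P 2F = P₃.pencil
  P 3F = P₄.pencil

  centres-in-general-position : GeneralPosition (λ k → centre (P k))
  centres-in-general-position =
    frame-general-position (λ k → centre (P k)) λ { 0F → refl ; 1F → refl ; 2F → refl ; 3F → refl }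

  m : ℕ
  m = cube L

  gridPoint : ℕ → ℕ → ℕ → Point
  gridPoint i j k = point (X i) (Y j) (Z k) , point-nonzero (X i) (Y j) (Z k) (scaled-nonzero 1 i)

  triple : Fin m → Fin L × Fin L × Fin L
  triple p = proj₁ (remQuot {L} (L * L) p) , remQuot {L} L (proj₂ (remQuot {L} (L * L) p))

  triple-injective : ∀ {p p'} → triple p ≡ triple p' → p ≡ p'
  triple-injective {p} {p'} eq = remQuot-injective {L} (L * L) {p} {p'}
    (cong₂ _,_ (cong proj₁ eq)
               (remQuot-injective {L} L {proj₂ (remQuot {L} (L * L) p)} {proj₂ (remQuot {L} (L * L) p')}
                                  (cong proj₂ eq)))

  gridAt : Fin L × Fin L × Fin L → Point
  gridAt (i , j , k) = gridPoint (toℕ i) (toℕ j) (toℕ k)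

  xs : Fin m → Point
  xs p = gridAt (triple p)

  -- Both ratios X : Y and X : Z recover the digits of a grid point.
  grid-injective : ∀ {i j k i' j' k'} → i < L → j < L → k < L → i' < L → j' < L → k' < L →
                   SamePoint (gridPoint i j k) (gridPoint i' j' k') → i ≡ i' × j ≡ j' × k ≡ k'
  grid-injective {i} {j} {k} {i'} {j'} {k'} i<L j<L k<L i'<L j'<L k'<L same =
    proj₁ ij≡ , proj₂ ij≡ , proj₂ ik≡
    where
      ratios : SameRatio (X i) (Y j) (X i') (Y j') × SameRatio (X i) (Z k) (X i') (Z k')
      ratios = ratio-points (X i) (Y j) (Z k) (X i') (Y j') (Z k') same
      ij≡ : i ≡ i' × j ≡ j'
      ij≡ = R₃.offsets-injective i<L (<-≤-trans j<L L≤n) i'<L (<-≤-trans j'<L L≤n) (proj₁ ratios)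
      ik≡ : i ≡ i' × k ≡ k'
      ik≡ = R₂.offsets-injective i<L (<-≤-trans k<L L≤n) i'<L (<-≤-trans k'<L L≤n) (proj₂ ratios)

  gridAt-injective : ∀ u v → SamePoint (gridAt u) (gridAt v) → u ≡ v
  gridAt-injective (i , j , k) (i' , j' , k') same =
    cong₂ _,_ (toℕ-injective (proj₁ digits≡))
              (cong₂ _,_ (toℕ-injective (proj₁ (proj₂ digits≡))) (toℕ-injective (proj₂ (proj₂ digits≡))))
    where
      digits≡ : toℕ i ≡ toℕ i' × toℕ j ≡ toℕ j' × toℕ k ≡ toℕ k'
      digits≡ = grid-injective (toℕ<n i) (toℕ<n j) (toℕ<n k) (toℕ<n i') (toℕ<n j') (toℕ<n k') same

  xs-distinct : ∀ p p' → p ≢ p' → ¬ SamePoint (xs p) (xs p')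
  xs-distinct p p' p≢p' same = p≢p' (triple-injective (gridAt-injective (triple p) (triple p') same))

  -- gap a b = a − b shifted into [0, 2l]; it is a digit below W.
  gap : ℕ → ℕ → ℕ
  gap a b = l + a ∸ b

  gap-< : ∀ {a} b → a < L → gap a b < W
  gap-< {a} b a<L = s≤s (≤-trans (m∸n≤m (l + a) b) (+-monoʳ-≤ l (≤-pred a<L)))

  gap-+ : ∀ a {b} → b < L → gap a b + b ≡ l + a
  gap-+ a b<L = m∸n+n≡m (≤-trans (≤-pred b<L) (m≤m+n l a))

  Y-X : ∀ {i} j → i < L → 1 * N + (L + 1 + gap j i) + X i ≡ Y j
  Y-X {i} j i<L = begin
    1 * N + (L + 1 + gap j i) + (1 * N + i) ≡⟨ regroup N l (gap j i) i ⟩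
    2 * N + (L + 1) + (gap j i + i)         ≡⟨ cong (2 * N + (L + 1) +_) (gap-+ j i<L) ⟩
    2 * N + (L + 1) + (l + j)               ≡⟨ close N l j ⟩
    2 * N + (2 * L + j)                     ∎
    where
      open ≡-Reasoning
      regroup : ∀ N l g i → 1 * N + (suc l + 1 + g) + (1 * N + i) ≡ 2 * N + (suc l + 1) + (g + i)
      regroup = solve-∀
      close : ∀ N l j → 2 * N + (suc l + 1) + (l + j) ≡ 2 * N + (2 * suc l + j)
      close = solve-∀

  Z-Y : ∀ {j} k → j < L → 1 * N + (4 * L + 1 + gap k j) + Y j ≡ Z k
  Z-Y {j} k j<L = begin
    1 * N + (4 * L + 1 + gap k j) + (2 * N + (2 * L + j)) ≡⟨ regroup N l (gap k j) j ⟩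
    3 * N + (6 * L + 1) + (gap k j + j)                   ≡⟨ cong (3 * N + (6 * L + 1) +_) (gap-+ k j<L) ⟩
    3 * N + (6 * L + 1) + (l + k)                         ≡⟨ close N l k ⟩
    3 * N + (7 * L + k)                                   ∎
    where
      open ≡-Reasoning
      regroup : ∀ N l g j → 1 * N + (4 * suc l + 1 + g) + (2 * N + (2 * suc l + j)) ≡ 3 * N + (6 * suc l + 1) + (g + j)
      regroup = solve-∀
      close : ∀ N l k → 3 * N + (6 * suc l + 1) + (l + k) ≡ 3 * N + (7 * suc l + k)
      close = solve-∀

  on-indexed : ∀ D .{{_ : NonZero D}} (g : ℕ → ℕ → Vec3) r q {x} → r < D → dot (g r q) x ≡ 0# →
               dot (g ((r + q * D) % D) ((r + q * D) / D)) x ≡ 0#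
  on-indexed D g r q {x} r<D on = subst (λ v → dot v x ≡ 0#) (sym (decode D g r<D)) on

  grid-rich : ∀ {i j k} → i < L → j < L → k < L → FourRich P (gridPoint i j k)
  grid-rich {i} {j} {k} i<L j<L k<L 0F = P₁.on-pencil (gridPoint i j k) (<-≤-trans (index-< j<L k<L) L²≤n)
    (on-indexed L (λ a b → line₁ (Y a) (Z b)) j k j<L (incident₁ (X i) (Y j) (Z k)))
  grid-rich {i} {j} {k} i<L j<L k<L 1F = P₂.on-pencil (gridPoint i j k) (<-≤-trans (index-< i<L k<L) L²≤n)
    (on-indexed L (λ a b → line₂ (X a) (Z b)) i k i<L (incident₂ (X i) (Y j) (Z k)))
  grid-rich {i} {j} {k} i<L j<L k<L 2F = P₃.on-pencil (gridPoint i j k) (<-≤-trans (index-< i<L j<L) L²≤n)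
    (on-indexed L (λ a b → line₃ (X a) (Y b)) i j i<L (incident₃ (X i) (Y j) (Z k)))
  grid-rich {i} {j} {k} i<L j<L k<L 3F = P₄.on-pencil (gridPoint i j k)
    (<-≤-trans (index-< (gap-< i j<L) (gap-< j k<L)) W²≤n)
    (on-indexed W (λ r q → line₄ (1 * N + (4 * L + 1 + q)) (1 * N + (L + 1 + r))) (gap j i) (gap k j) (gap-< i j<L)
      (incident₄ (1 * N + (4 * L + 1 + gap k j)) (1 * N + (L + 1 + gap j i)) (X i) (Y j) (Z k)
                 (Z-Y k j<L) (Y-X j i<L)))

  gridAt-rich : ∀ u → FourRich P (gridAt u)
  gridAt-rich (i , j , k) = grid-rich (toℕ<n i) (toℕ<n j) (toℕ<n k)

  xs-rich : ∀ p → FourRich P (xs p)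
  xs-rich p = gridAt-rich (triple p)

theorem3 : (R : RealField) → let open RealField R in let open Projective R in
    ∃ λ (c : Carrier) → 0# < c × ∀ (n : ℕ) → 1 ≤ℕ n →
      ∃ λ (P : Fin 4 → Pencil n) → GeneralPosition (λ k → centre (P k)) ×
        ∃ λ (m : ℕ) → ∃ λ (xs : Fin m → Point) →
          (∀ i j → i ≢ j → ¬ SamePoint (xs i) (xs j)) ×
          (∀ i → FourRich P (xs i)) ×
          (c * c * fromℕ (n ^ 3) ≤ fromℕ m * fromℕ m)
theorem3 R = c , 0<c , λ n 1≤n →
  let (l , sq≤n , n<sq) = bracket oddSquare oddSquare-incr 1≤n
      open Construction R n l sq≤n
  in P , centres-in-general-position , m , xs , xs-distinct , xs-rich , grid-large l n<sq
  where
    open Arithmetic using (bracket; oddSquare; oddSquare-incr; cube; cube-bound)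
    open OrderedField R

    inverse-27 : ∃ λ c → fromℕ 27 * c ≡ 1#
    inverse-27 = inverse (fromℕ 27) (fromℕ-nonzero {27} λ ())

    c : Carrier
    c = proj₁ inverse-27

    0<c : 0# < c
    0<c = inverse-pos (fromℕ-pos 26) (proj₂ inverse-27)

    grid-large : ∀ {n} l → n ℕ.< oddSquare (ℕ.suc l) →
                 c * c * fromℕ (n ^ 3) ≤ fromℕ (cube (ℕ.suc l)) * fromℕ (cube (ℕ.suc l))
    grid-large {n} l n<sq = subst (c * c * fromℕ (n ^ 3) ≤_) (fromℕ-* (cube (ℕ.suc l)) (cube (ℕ.suc l)))
      (reciprocal-bound 27 (cube (ℕ.suc l) ℕ.* cube (ℕ.suc l)) (proj₂ inverse-27) (inj₁ 0<c) (cube-bound l n<sq))
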